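{- Let $m$ be any positive integer and let $F = P_3 \sqcup mK_1$. Then $D[F] = v(F) - 1$.
   Context: All graphs are finite simple graphs. Consider first-order logic over graphs whose signature consists of two binary predicate symbols: $\sim$ (adjacency) and $=$ (equality). For a graph $F$, let $\mathcal{C}[F]$ be the property (class of graphs) of containing an induced subgraph isomorphic to $F$. A sentence $\varphi$ expresses $\mathcal{C}[F]$ if for every graph $G$: $G \models \varphi \iff G \in \mathcal{C}[F]$. $D[F]$ denotes the minimal quantifier depth (maximal length of a chain of nested quantifiers) of a first-order sentence expressing $\mathcal{C}[F]$. $v(F)$ is the number of vertices of $F$. $P_3$ is the path on $3$ vertices, $K_1$ is the one-vertex graph, $A \sqcup B$ denotes disjoint union, and $mA$ denotes the disjoint union of $m$ copies of $A$. -}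

module Defs where

open import Data.Nat using (ℕ; zero; suc; _+_; _∸_; _⊔_; _≤_)
open import Data.Fin using (Fin; zero; suc; splitAt)
open import Data.Bool using (Bool; true; false)
open import Data.Sum using (_⊎_; inj₁; inj₂)
open import Data.Product using (Σ; _×_; _,_)
open import Relation.Binary.PropositionalEquality using (_≡_; refl)
open import Relation.Nullary using (¬_)
open import Function.Definitions using (Injective)
open import Function.Bundles using (_⇔_)

record Graph : Set where
  field
    V      : ℕ
    adj    : Fin V → Fin V → Bool
    sym    : ∀ i j → adj i j ≡ adj j i
    irrefl : ∀ i → adj i i ≡ false
open Graph public

v : Graph → ℕ
v = V

emptyG : Graph
emptyG = record { V = 0 ; adj = λ () ; sym = λ () ; irrefl = λ () }

K₁ : Graph
K₁ = record { V = 1 ; adj = λ _ _ → false ; sym = λ _ _ → refl ; irrefl = λ _ → refl }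

P₃adj : Fin 3 → Fin 3 → Bool
P₃adj zero (suc zero) = true
P₃adj (suc zero) zero = true
P₃adj (suc zero) (suc (suc zero)) = true
P₃adj (suc (suc zero)) (suc zero) = true
P₃adj _ _ = false

P₃sym : ∀ i j → P₃adj i j ≡ P₃adj j i
P₃sym zero zero = refl
P₃sym zero (suc zero) = refl
P₃sym zero (suc (suc zero)) = refl
P₃sym (suc zero) zero = refl
P₃sym (suc zero) (suc zero) = refl
P₃sym (suc zero) (suc (suc zero)) = refl
P₃sym (suc (suc zero)) zero = refl
P₃sym (suc (suc zero)) (suc zero) = refl
P₃sym (suc (suc zero)) (suc (suc zero)) = refl

P₃irr : ∀ i → P₃adj i i ≡ false
P₃irr zero = refl
P₃irr (suc zero) = refl
P₃irr (suc (suc zero)) = refl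

P₃ : Graph
P₃ = record { V = 3 ; adj = P₃adj ; sym = P₃sym ; irrefl = P₃irr }

-- disjoint union A ⊔ B: vertices of A first, then vertices of B
module _ (A B : Graph) where
  private
    sAdj : Fin (V A) ⊎ Fin (V B) → Fin (V A) ⊎ Fin (V B) → Bool
    sAdj (inj₁ i) (inj₁ j) = adj A i j
    sAdj (inj₂ i) (inj₂ j) = adj B i j
    sAdj _ _ = false

    sSym : ∀ x y → sAdj x y ≡ sAdj y x
    sSym (inj₁ i) (inj₁ j) = sym A i j
    sSym (inj₁ i) (inj₂ j) = refl
    sSym (inj₂ i) (inj₁ j) = refl
    sSym (inj₂ i) (inj₂ j) = sym B i j

    sIrr : ∀ x → sAdj x x ≡ false
    sIrr (inj₁ i) = irrefl A i
    sIrr (inj₂ i) = irrefl B i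

  _⊔ᴳ_ : Graph
  _⊔ᴳ_ = record
    { V = V A + V B
    ; adj = λ i j → sAdj (splitAt (V A) i) (splitAt (V A) j)
    ; sym = λ i j → sSym (splitAt (V A) i) (splitAt (V A) j)
    ; irrefl = λ i → sIrr (splitAt (V A) i)
    }

_·ᴳ_ : ℕ → Graph → Graph
zero  ·ᴳ A = emptyG
suc m ·ᴳ A = A ⊔ᴳ (m ·ᴳ A)

Contains : Graph → Graph → Set
Contains G F =
  Σ (Fin (V F) → Fin (V G)) λ f →
    Injective _≡_ _≡_ f × (∀ i j → adj G (f i) (f j) ≡ adj F i j)

-- First-order logic over graphs with ∼ and =.
-- Formula k: formulas with free variables among k de Bruijn variables.

data Formula (k : ℕ) : Set where
  _≐_ : Fin k → Fin k → Formula k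
  _∼_ : Fin k → Fin k → Formula k
  ¬'_ : Formula k → Formula k
  _∧'_ : Formula k → Formula k → Formula k
  _∨'_ : Formula k → Formula k → Formula k
  _⇒'_ : Formula k → Formula k → Formula k
  ∃'_ : Formula (suc k) → Formula k
  ∀'_ : Formula (suc k) → Formula k

Sentence : Set
Sentence = Formula 0

qd : ∀ {k} → Formula k → ℕ
qd (x ≐ y) = 0
qd (x ∼ y) = 0
qd (¬' φ) = qd φ
qd (φ ∧' ψ) = qd φ ⊔ qd ψ
qd (φ ∨' ψ) = qd φ ⊔ qd ψ
qd (φ ⇒' ψ) = qd φ ⊔ qd ψ
qd (∃' φ) = suc (qd φ)
qd (∀' φ) = suc (qd φ)

extend : ∀ {k n} → (Fin k → Fin n) → Fin n → Fin (suc k) → Fin n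
extend ρ a zero = a
extend ρ a (suc i) = ρ i

Sat : (G : Graph) → ∀ {k} → Formula k → (Fin k → Fin (V G)) → Set
Sat G (x ≐ y) ρ = ρ x ≡ ρ y
Sat G (x ∼ y) ρ = adj G (ρ x) (ρ y) ≡ true
Sat G (¬' φ) ρ = ¬ Sat G φ ρ
Sat G (φ ∧' ψ) ρ = Sat G φ ρ × Sat G ψ ρ
Sat G (φ ∨' ψ) ρ = Sat G φ ρ ⊎ Sat G ψ ρ
Sat G (φ ⇒' ψ) ρ = Sat G φ ρ → Sat G ψ ρ
Sat G (∃' φ) ρ = Σ (Fin (V G)) λ a → Sat G φ (extend ρ a)
Sat G (∀' φ) ρ = (a : Fin (V G)) → Sat G φ (extend ρ a)

_⊨_ : Graph → Sentence → Set
G ⊨ φ = Sat G φ (λ ())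

Expresses : Sentence → Graph → Set
Expresses φ F = ∀ G → (G ⊨ φ) ⇔ Contains G F

D[_]≡_ : Graph → ℕ → Set
D[ F ]≡ d =
  (Σ Sentence λ φ → qd φ ≡ d × Expresses φ F)
  × (∀ φ → Expresses φ F → d ≤ qd φ)

module Submission where

-- D[F] = n + 3 for F = P₃ ⊔ (n+1) K₁, whose v(F) - 1 is n + 3.
-- Upper bound: the sentence ψ n of depth n + 3 expresses 𝒞[F].  Its first n
-- quantifiers pick isolated vertices, each apart (distinct, non-adjacent) from
-- the earlier ones; a depth-3 core then asks, among the vertices apart from
-- these, for an independent triple x, y₁, z₁ and a path x - y - w with a vertex
-- z apart from x, y, which by a short case analysis forces an induced P₃ ⊔ K₁.
-- Lower bound: by soundness of Ehrenfeucht–Fraïssé games it suffices that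
-- Duplicator survives n + 2 rounds on G = C₅ ⊔ (n+1) K₂ ∈ 𝒞[F] and
-- H = C₅ ⊔ n K₂ ∉ 𝒞[F].  She keeps the G-position the image of the H-position
-- under a relabelling of the copies of K₂, re-routing an untouched copy when
-- Spoiler enters a fresh one; once all copies in H are used, counting leaves at
-- most two rounds, survived with the help of C₅.

open import Defs hiding (sym)
open import Data.Bool using (Bool; true; false; not; _∧_; _∨_)
open import Data.Bool.Properties using (∧-zeroʳ; ¬-not) renaming (_≟_ to _≟ᵇ_)
open import Data.Empty using (⊥; ⊥-elim)
open import Data.Fin using (Fin; zero; suc; toℕ; join; splitAt; cast; _↑ʳ_)
open import Data.Fin.Properties
  using ( _≟_; suc-injective; all?; any?; ¬∀⟶∃¬; injective⇒≤; +↔⊎; *↔×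
        ; splitAt-join; join-splitAt; cast-involutive)
open import Data.Nat
  using (ℕ; zero; suc; _+_; _*_; _∸_; _%_; _≤_; s≤s; s≤s⁻¹) renaming (_≟_ to _≟ℕ_)
open import Data.Nat.Properties
  using ( m⊔n≤o⇒m≤o; m⊔n≤o⇒n≤o; _≤?_; ≰⇒>; 1+n≰n; ≤-trans; +-suc; m≤n+m
        ; ≤-reflexive; +-identityʳ)
open import Data.Product using (Σ; _×_; _,_; proj₁; proj₂)
open import Data.Product.Function.NonDependent.Propositional using (_×-⇔_)
open import Data.Product.Properties using (,-injectiveˡ; ,-injectiveʳ)
open import Data.Sum using (_⊎_; inj₁; inj₂; [_,_])
open import Data.Sum.Function.Propositional using (_⊎-⇔_; _⊎-↔_)
open import Data.Sum.Properties using (inj₁-injective; inj₂-injective)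
open import Data.Unit using (⊤; tt)
open import Function using (_∘_; _∋_)
open import Function.Bundles using (_⇔_; mk⇔; Equivalence; _↔_; Inverse)
open import Function.Definitions using (Injective)
open import Function.Construct.Composition using (_⇔-∘_)
open import Function.Construct.Symmetry using (⇔-sym)
open import Function.Properties.Inverse using (↔-refl; ↔-trans)
open import Function.Related.TypeIsomorphisms using (→-cong-⇔; ¬-cong-⇔)
open import Relation.Binary.Definitions using (DecidableEquality)
open import Relation.Binary.PropositionalEquality
  using (_≡_; _≢_; refl; sym; trans; cong; cong₂; subst; subst₂)
open import Relation.Nullary using (¬_; Dec; yes; no; does)
open import Relation.Nullary.Decidable using (dec-true; dec-false; from-yes; _→-dec_; _×-dec_; ¬?)

open Equivalence using (to; from)

-- A simple graph on an arbitrary vertex type.  The graphs of Defs have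
-- vertex set Fin N; structures allow building graphs from sums and products.
record Structure : Set₁ where
  field
    Carrier  : Set
    _~_      : Carrier → Carrier → Bool
    ~-sym    : ∀ x y → x ~ y ≡ y ~ x
    ~-irrefl : ∀ x → x ~ x ≡ false
open Structure

adjacent : (S : Structure) → Carrier S → Carrier S → Bool
adjacent = _~_
syntax adjacent S x y = x ~⟨ S ⟩ y

⟦_⟧ : Graph → Structure
⟦ G ⟧ = record { Carrier = Fin (V G) ; _~_ = adj G ; ~-sym = Graph.sym G ; ~-irrefl = irrefl G }

true-and-false : ∀ {b} → b ≡ true → b ≡ false → ⊥
true-and-false refl ()

separated⇒distinct : ∀ S {x y z} → x ~⟨ S ⟩ z ≡ true → y ~⟨ S ⟩ z ≡ false → x ≢ y
separated⇒distinct S x~z y≁z refl = true-and-false x~z y≁z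

adjacent⇒distinct : ∀ S {x y} → x ~⟨ S ⟩ y ≡ true → x ≢ y
adjacent⇒distinct S {y = y} x~y = separated⇒distinct S x~y (~-irrefl S y)

Apart : (S : Structure) → Carrier S → Carrier S → Set
Apart S x y = x ≢ y × x ~⟨ S ⟩ y ≡ false

apart-sym : ∀ S {x y} → Apart S x y → Apart S y x
apart-sym S {x} {y} (x≢y , x≁y) = x≢y ∘ sym , trans (~-sym S y x) x≁y

SameType : (S T : Structure) → Carrier S → Carrier S → Carrier T → Carrier T → Set
SameType S T x y x' y' = (x ≡ y ⇔ x' ≡ y') × x ~⟨ S ⟩ y ≡ x' ~⟨ T ⟩ y'

apart-sameType : ∀ S T {x y x' y'} → Apart S x y → Apart T x' y' → SameType S T x y x' y'
apart-sameType S T (x≢y , x≁y) (x'≢y' , x'≁y') =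
  mk⇔ (⊥-elim ∘ x≢y) (⊥-elim ∘ x'≢y') , trans x≁y (sym x'≁y')

adjacent-sameType : ∀ S T {x y x' y'} → x ~⟨ S ⟩ y ≡ true → x' ~⟨ T ⟩ y' ≡ true →
  SameType S T x y x' y'
adjacent-sameType S T x~y x'~y' =
  mk⇔ (⊥-elim ∘ adjacent⇒distinct S x~y) (⊥-elim ∘ adjacent⇒distinct T x'~y') , trans x~y (sym x'~y')

retraction⇒injective : ∀ {A B : Set} {h : A → B} (g : B → A) →
  (∀ x → g (h x) ≡ x) → ∀ {x y} → h x ≡ h y → x ≡ y
retraction⇒injective g gh {x} {y} e = trans (sym (gh x)) (trans (cong g e) (gh y))

record _≅_ (S T : Structure) : Set where
  field
    f     : Carrier S → Carrier T
    f⁻¹   : Carrier T → Carrier S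
    f∘f⁻¹ : ∀ y → f (f⁻¹ y) ≡ y
    f⁻¹∘f : ∀ x → f⁻¹ (f x) ≡ x
    f-adj : ∀ x y → f x ~⟨ T ⟩ f y ≡ x ~⟨ S ⟩ y

  f-injective : ∀ {x y} → f x ≡ f y → x ≡ y
  f-injective = retraction⇒injective f⁻¹ f⁻¹∘f

≅-sym : ∀ {S T} → S ≅ T → T ≅ S
≅-sym {S} {T} F = record
  { f = f⁻¹ ; f⁻¹ = f ; f∘f⁻¹ = f⁻¹∘f ; f⁻¹∘f = f∘f⁻¹
  ; f-adj = λ x y → trans (sym (f-adj (f⁻¹ x) (f⁻¹ y)))
                          (cong₂ (adjacent T) (f∘f⁻¹ x) (f∘f⁻¹ y)) }
  where open _≅_ F

open _≅_ using (f; f⁻¹; f∘f⁻¹)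

_▷_ : ∀ {X : Set} {k} → (Fin k → X) → X → Fin (suc k) → X
(ρ ▷ a) zero    = a
(ρ ▷ a) (suc i) = ρ i

▷-image : ∀ {X Y : Set} {k} (h : X → Y) {ρ : Fin k → X} {ρ' a a'} →
  (∀ i → h (ρ i) ≡ ρ' i) → h a ≡ a' → ∀ i → h ((ρ ▷ a) i) ≡ (ρ' ▷ a') i
▷-image h hρ ha zero    = ha
▷-image h hρ ha (suc i) = hρ i

PartialIso : (S T : Structure) → ∀ {k} → (Fin k → Carrier S) → (Fin k → Carrier T) → Set
PartialIso S T ρ σ = ∀ i j → SameType S T (ρ i) (ρ j) (σ i) (σ j)

partialIso-extend : ∀ S T {k} {ρ : Fin k → Carrier S} {σ : Fin k → Carrier T} {a b} →
  PartialIso S T ρ σ → (∀ i → SameType S T a (ρ i) b (σ i)) → PartialIso S T (ρ ▷ a) (σ ▷ b)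
partialIso-extend S T {a = a} {b} P new zero zero =
  mk⇔ (λ _ → refl) (λ _ → refl) , trans (~-irrefl S a) (sym (~-irrefl T b))
partialIso-extend S T P new zero (suc j) = new j
partialIso-extend S T {ρ = ρ} {σ} {a} {b} P new (suc i) zero =
  mk⇔ (sym ∘ to (proj₁ (new i)) ∘ sym) (sym ∘ from (proj₁ (new i)) ∘ sym) ,
  trans (~-sym S (ρ i) a) (trans (proj₂ (new i)) (~-sym T b (σ i)))
partialIso-extend S T P new (suc i) (suc j) = P i j

partialIso-transport : ∀ {S S' T T'} (F : S ≅ S') (G : T ≅ T') {k}
  {ρ : Fin k → Carrier S} {σ : Fin k → Carrier T} {ρ' : Fin k → Carrier S'} {σ' : Fin k → Carrier T'} →
  (∀ i → f F (ρ i) ≡ ρ' i) → (∀ i → f G (σ i) ≡ σ' i) →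
  PartialIso S T ρ σ → PartialIso S' T' ρ' σ'
partialIso-transport F G {ρ = ρ} {σ} hρ hσ P i j
  rewrite sym (hρ i) | sym (hρ j) | sym (hσ i) | sym (hσ j) =
  mk⇔ (cong (f G) ∘ to (proj₁ (P i j)) ∘ _≅_.f-injective F)
      (cong (f F) ∘ from (proj₁ (P i j)) ∘ _≅_.f-injective G) ,
  trans (_≅_.f-adj F (ρ i) (ρ j)) (trans (proj₂ (P i j)) (sym (_≅_.f-adj G (σ i) (σ j))))

-- Duplicator survives r more rounds of the Ehrenfeucht–Fraïssé game on S
-- and T from the position in which the pebbles lie on ρ and σ.
EF : (S T : Structure) → ℕ → ∀ {k} → (Fin k → Carrier S) → (Fin k → Carrier T) → Set
EF S T zero    ρ σ = PartialIso S T ρ σ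
EF S T (suc r) ρ σ = PartialIso S T ρ σ
  × (∀ a → Σ (Carrier T) λ b → EF S T r (ρ ▷ a) (σ ▷ b))
  × (∀ b → Σ (Carrier S) λ a → EF S T r (ρ ▷ a) (σ ▷ b))

EF⇒partialIso : ∀ {S T} r {k} {ρ : Fin k → Carrier S} {σ} → EF S T r ρ σ → PartialIso S T ρ σ
EF⇒partialIso zero    e = e
EF⇒partialIso (suc r) e = proj₁ e

-- Games are invariant under isomorphism: Duplicator answers a move in S' by
-- pulling it back to S, answering there, and pushing the answer to T'.
EF-transport : ∀ {S S' T T'} (F : S ≅ S') (G : T ≅ T') r {k}
  {ρ : Fin k → Carrier S} {σ : Fin k → Carrier T} {ρ' : Fin k → Carrier S'} {σ' : Fin k → Carrier T'} →
  (∀ i → f F (ρ i) ≡ ρ' i) → (∀ i → f G (σ i) ≡ σ' i) → EF S T r ρ σ → EF S' T' r ρ' σ'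
EF-transport F G zero    hρ hσ P = partialIso-transport F G hρ hσ P
EF-transport F G (suc r) hρ hσ (P , forth , back) =
  partialIso-transport F G hρ hσ P ,
  (λ a' → let (b , e) = forth (f⁻¹ F a') in
    f G b , EF-transport F G r (▷-image (f F) hρ (f∘f⁻¹ F a')) (▷-image (f G) hσ refl) e) ,
  (λ b' → let (a , e) = back (f⁻¹ G b') in
    f F a , EF-transport F G r (▷-image (f F) hρ refl) (▷-image (f G) hσ (f∘f⁻¹ G b')) e)

extend▷ : ∀ {k n} (ρ : Fin k → Fin n) {a} i → (ρ ▷ a) i ≡ extend ρ a i
extend▷ ρ zero    = refl
extend▷ ρ (suc i) = refl

extend-cong : ∀ {k n} {ρ ρ' : Fin k → Fin n} a → (∀ i → ρ i ≡ ρ' i) →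
  ∀ i → extend ρ a i ≡ extend ρ' a i
extend-cong a e zero    = refl
extend-cong a e (suc i) = e i

sat-cong : ∀ G {k} (φ : Formula k) {ρ ρ' : Fin k → Fin (V G)} →
  (∀ i → ρ i ≡ ρ' i) → Sat G φ ρ ⇔ Sat G φ ρ'
sat-cong G (x ≐ y) e = mk⇔ (subst₂ _≡_ (e x) (e y)) (subst₂ _≡_ (sym (e x)) (sym (e y)))
sat-cong G (x ∼ y) e = mk⇔ (subst₂ edge (e x) (e y)) (subst₂ edge (sym (e x)) (sym (e y)))
  where
  edge : Fin (V G) → Fin (V G) → Set
  edge u w = adj G u w ≡ true
sat-cong G (¬' φ)   e = ¬-cong-⇔ (sat-cong G φ e)
sat-cong G (φ ∧' ψ) e = sat-cong G φ e ×-⇔ sat-cong G ψ e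
sat-cong G (φ ∨' ψ) e = sat-cong G φ e ⊎-⇔ sat-cong G ψ e
sat-cong G (φ ⇒' ψ) e = →-cong-⇔ (sat-cong G φ e) (sat-cong G ψ e)
sat-cong G (∃' φ)   e = mk⇔ (λ (a , p) → a , to (sat-cong G φ (extend-cong a e)) p)
                            (λ (a , p) → a , from (sat-cong G φ (extend-cong a e)) p)
sat-cong G (∀' φ)   e = mk⇔ (λ g a → to (sat-cong G φ (extend-cong a e)) (g a))
                            (λ g a → from (sat-cong G φ (extend-cong a e)) (g a))

EF-sound : ∀ {G H} r {k} (φ : Formula k) {ρ : Fin k → Fin (V G)} {σ : Fin k → Fin (V H)} →
  EF ⟦ G ⟧ ⟦ H ⟧ r ρ σ → qd φ ≤ r → Sat G φ ρ ⇔ Sat H φ σ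

EF-sound-move : ∀ {G H} r {k} (φ : Formula (suc k)) {ρ : Fin k → Fin (V G)} {σ : Fin k → Fin (V H)} {a b} →
  EF ⟦ G ⟧ ⟦ H ⟧ r (ρ ▷ a) (σ ▷ b) → qd φ ≤ r → Sat G φ (extend ρ a) ⇔ Sat H φ (extend σ b)
EF-sound-move {G} {H} r φ {ρ} {σ} e q =
  sat-cong H φ (extend▷ σ) ⇔-∘ (EF-sound r φ e q ⇔-∘ sat-cong G φ (sym ∘ extend▷ ρ))

EF-sound r (x ≐ y) e _ = proj₁ (EF⇒partialIso r e x y)
EF-sound r (x ∼ y) e _ =
  mk⇔ (trans (sym (proj₂ (EF⇒partialIso r e x y)))) (trans (proj₂ (EF⇒partialIso r e x y)))
EF-sound r (¬' φ)   e q = ¬-cong-⇔ (EF-sound r φ e q)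
EF-sound r (φ ∧' ψ) e q =
  EF-sound r φ e (m⊔n≤o⇒m≤o (qd φ) _ q) ×-⇔ EF-sound r ψ e (m⊔n≤o⇒n≤o (qd φ) _ q)
EF-sound r (φ ∨' ψ) e q =
  EF-sound r φ e (m⊔n≤o⇒m≤o (qd φ) _ q) ⊎-⇔ EF-sound r ψ e (m⊔n≤o⇒n≤o (qd φ) _ q)
EF-sound r (φ ⇒' ψ) e q =
  →-cong-⇔ (EF-sound r φ e (m⊔n≤o⇒m≤o (qd φ) _ q)) (EF-sound r ψ e (m⊔n≤o⇒n≤o (qd φ) _ q))
EF-sound (suc r) (∃' φ) (_ , forth , back) (s≤s q) =
  mk⇔ (λ (a , p) → let (b , e) = forth a in b , to (EF-sound-move r φ e q) p)
      (λ (b , p) → let (a , e) = back b in a , from (EF-sound-move r φ e q) p)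
EF-sound (suc r) (∀' φ) (_ , forth , back) (s≤s q) =
  mk⇔ (λ g b → let (a , e) = back b in to (EF-sound-move r φ e q) (g a))
      (λ g a → let (b , e) = forth a in from (EF-sound-move r φ e q) (g b))

depth-lower-bound : ∀ F G H r {ρ : Fin 0 → Fin (V G)} {σ : Fin 0 → Fin (V H)} →
  EF ⟦ G ⟧ ⟦ H ⟧ r ρ σ → Contains G F → ¬ Contains H F →
  ∀ φ → Expresses φ F → suc r ≤ qd φ
depth-lower-bound F G H r e G∈ H∉ φ expr with suc r ≤? qd φ
... | yes r<qd = r<qd
... | no  r≮qd = ⊥-elim (H∉ (to (expr H) H⊨φ))
  where
  none : ∀ {n} {τ τ' : Fin 0 → Fin n} i → τ i ≡ τ' i
  none ()
  H⊨φ : H ⊨ φ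
  H⊨φ = to (sat-cong H φ none ⇔-∘ (EF-sound r φ e (s≤s⁻¹ (≰⇒> r≮qd)) ⇔-∘ sat-cong G φ none))
           (from (expr G) G∈)

record InducedP₃K₁ (S : Structure) (m : ℕ) : Set where
  field
    a b c    : Carrier S
    isolated : Fin m → Carrier S
    a~b   : a ~⟨ S ⟩ b ≡ true
    b~c   : b ~⟨ S ⟩ c ≡ true
    a≁c   : a ~⟨ S ⟩ c ≡ false
    a≢c   : a ≢ c
    a≁iso : ∀ t → a ~⟨ S ⟩ isolated t ≡ false
    b≁iso : ∀ t → b ~⟨ S ⟩ isolated t ≡ false
    c≁iso : ∀ t → c ~⟨ S ⟩ isolated t ≡ false
    iso≁iso : ∀ t u → isolated t ~⟨ S ⟩ isolated u ≡ false
    iso-injective : ∀ {t u} → isolated t ≡ isolated u → t ≡ u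

module _ {S : Structure} {m : ℕ} (W : InducedP₃K₁ S m) where
  open InducedP₃K₁ W

  pathOf : Fin 3 → Carrier S
  pathOf zero             = a
  pathOf (suc zero)       = b
  pathOf (suc (suc zero)) = c

  pathOf-adj : ∀ p q → pathOf p ~⟨ S ⟩ pathOf q ≡ P₃adj p q
  pathOf-adj zero             zero             = ~-irrefl S a
  pathOf-adj zero             (suc zero)       = a~b
  pathOf-adj zero             (suc (suc zero)) = a≁c
  pathOf-adj (suc zero)       zero             = trans (~-sym S b a) a~b
  pathOf-adj (suc zero)       (suc zero)       = ~-irrefl S b
  pathOf-adj (suc zero)       (suc (suc zero)) = b~c
  pathOf-adj (suc (suc zero)) zero             = trans (~-sym S c a) a≁c
  pathOf-adj (suc (suc zero)) (suc zero)       = trans (~-sym S c b) b~c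
  pathOf-adj (suc (suc zero)) (suc (suc zero)) = ~-irrefl S c

  pathOf-injective : ∀ p q → pathOf p ≡ pathOf q → p ≡ q
  pathOf-injective zero             zero             _ = refl
  pathOf-injective (suc zero)       (suc zero)       _ = refl
  pathOf-injective (suc (suc zero)) (suc (suc zero)) _ = refl
  pathOf-injective zero             (suc zero)       e = ⊥-elim (adjacent⇒distinct S a~b e)
  pathOf-injective (suc zero)       zero             e = ⊥-elim (adjacent⇒distinct S a~b (sym e))
  pathOf-injective (suc zero)       (suc (suc zero)) e = ⊥-elim (adjacent⇒distinct S b~c e)
  pathOf-injective (suc (suc zero)) (suc zero)       e = ⊥-elim (adjacent⇒distinct S b~c (sym e))
  pathOf-injective zero             (suc (suc zero)) e = ⊥-elim (a≢c e)
  pathOf-injective (suc (suc zero)) zero             e = ⊥-elim (a≢c (sym e))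

  -- each path vertex is apart from each isolated vertex: it has a path
  -- neighbour which the isolated vertex lacks
  path-apart-iso : ∀ p t → Apart S (pathOf p) (isolated t)
  path-apart-iso zero t =
    separated⇒distinct S a~b (trans (~-sym S _ b) (b≁iso t)) , a≁iso t
  path-apart-iso (suc zero) t =
    separated⇒distinct S (trans (~-sym S b a) a~b) (trans (~-sym S _ a) (a≁iso t)) , b≁iso t
  path-apart-iso (suc (suc zero)) t =
    separated⇒distinct S (trans (~-sym S c b) b~c) (trans (~-sym S _ b) (b≁iso t)) , c≁iso t

induced-transport : ∀ {S T m} → S ≅ T → InducedP₃K₁ S m → InducedP₃K₁ T m
induced-transport F W = record
  { a = f F a ; b = f F b ; c = f F c ; isolated = f F ∘ isolated
  ; a~b = trans (f-adj a b) a~b ; b~c = trans (f-adj b c) b~c ; a≁c = trans (f-adj a c) a≁c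
  ; a≢c = a≢c ∘ f-injective
  ; a≁iso = λ t → trans (f-adj a (isolated t)) (a≁iso t)
  ; b≁iso = λ t → trans (f-adj b (isolated t)) (b≁iso t)
  ; c≁iso = λ t → trans (f-adj c (isolated t)) (c≁iso t)
  ; iso≁iso = λ t u → trans (f-adj (isolated t) (isolated u)) (iso≁iso t u)
  ; iso-injective = iso-injective ∘ f-injective
  }
  where
  open _≅_ F using (f-adj; f-injective)
  open InducedP₃K₁ W

module _ (A B : Graph) where
  private
    ι : Fin (V A) ⊎ Fin (V B) → Fin (V (A ⊔ᴳ B))
    ι = join (V A) (V B)

  ⊔ᴳ-left : ∀ x y → adj (A ⊔ᴳ B) (ι (inj₁ x)) (ι (inj₁ y)) ≡ adj A x y
  ⊔ᴳ-left x y rewrite splitAt-join (V A) (V B) (inj₁ x) | splitAt-join (V A) (V B) (inj₁ y) = refl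

  ⊔ᴳ-cross : ∀ x y → adj (A ⊔ᴳ B) (ι (inj₁ x)) (ι (inj₂ y)) ≡ false
  ⊔ᴳ-cross x y rewrite splitAt-join (V A) (V B) (inj₁ x) | splitAt-join (V A) (V B) (inj₂ y) = refl

  ⊔ᴳ-right : ∀ x y → adj (A ⊔ᴳ B) (ι (inj₂ x)) (ι (inj₂ y)) ≡ adj B x y
  ⊔ᴳ-right x y rewrite splitAt-join (V A) (V B) (inj₂ x) | splitAt-join (V A) (V B) (inj₂ y) = refl

K₁s-size : ∀ m → V (m ·ᴳ K₁) ≡ m
K₁s-size zero    = refl
K₁s-size (suc m) = cong suc (K₁s-size m)

K₁s-edgeless : ∀ m i j → adj (m ·ᴳ K₁) i j ≡ false
K₁s-edgeless (suc m) i j with splitAt 1 i | splitAt 1 j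
... | inj₁ _ | inj₁ _ = refl
... | inj₁ _ | inj₂ _ = refl
... | inj₂ _ | inj₁ _ = refl
... | inj₂ x | inj₂ y = K₁s-edgeless m x y

join-injective : ∀ m n {x y : Fin m ⊎ Fin n} → join m n x ≡ join m n y → x ≡ y
join-injective m n = retraction⇒injective (splitAt m) (splitAt-join m n)

splitAt-injective : ∀ m n {i j : Fin (m + n)} → splitAt m i ≡ splitAt m j → i ≡ j
splitAt-injective m n = retraction⇒injective (join m n) (join-splitAt m n)

cast-injective : ∀ {m n} (e : m ≡ n) {x y : Fin m} → cast e x ≡ cast e y → x ≡ y
cast-injective e = retraction⇒injective (cast (sym e)) (cast-involutive (sym e) e)

Pat : ℕ → Graph
Pat m = P₃ ⊔ᴳ (m ·ᴳ K₁)

module _ (G : Graph) (m : ℕ) where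
  private
    K : Graph
    K = m ·ᴳ K₁

    isoV : Fin m → Fin (V (Pat m))
    isoV t = join 3 (V K) (inj₂ (cast (sym (K₁s-size m)) t))

  induced⇒contains : InducedP₃K₁ ⟦ G ⟧ m → Contains G (Pat m)
  induced⇒contains W =
    g ∘ splitAt 3 ,
    (λ {i} {j} e → splitAt-injective 3 (V K) (g-injective (splitAt 3 i) (splitAt 3 j) e)) ,
    (λ i j → trans (g-adj (splitAt 3 i) (splitAt 3 j))
                   (cong₂ (adj (Pat m)) (join-splitAt 3 (V K) i) (join-splitAt 3 (V K) j)))
    where
    open InducedP₃K₁ W
    S : Structure
    S = ⟦ G ⟧

    g : Fin 3 ⊎ Fin (V K) → Fin (V G)
    g = [ pathOf W , isolated ∘ cast (K₁s-size m) ]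

    g-adj : ∀ x y → adj G (g x) (g y) ≡ adj (Pat m) (join 3 (V K) x) (join 3 (V K) y)
    g-adj (inj₁ p) (inj₁ q) = trans (pathOf-adj W p q) (sym (⊔ᴳ-left P₃ K p q))
    g-adj (inj₁ p) (inj₂ y) = trans (proj₂ (path-apart-iso W p _)) (sym (⊔ᴳ-cross P₃ K p y))
    g-adj (inj₂ y) (inj₁ p) = trans (proj₂ (apart-sym S (path-apart-iso W p _)))
      (sym (trans (Graph.sym (Pat m) (join 3 (V K) (inj₂ y)) (join 3 (V K) (inj₁ p))) (⊔ᴳ-cross P₃ K p y)))
    g-adj (inj₂ y) (inj₂ z) = trans (iso≁iso _ _) (sym (trans (⊔ᴳ-right P₃ K y z) (K₁s-edgeless m y z)))

    g-injective : ∀ x y → g x ≡ g y → x ≡ y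
    g-injective (inj₁ p) (inj₁ q) e = cong inj₁ (pathOf-injective W p q e)
    g-injective (inj₁ p) (inj₂ y) e = ⊥-elim (proj₁ (path-apart-iso W p _) e)
    g-injective (inj₂ y) (inj₁ p) e = ⊥-elim (proj₁ (path-apart-iso W p _) (sym e))
    g-injective (inj₂ y) (inj₂ z) e = cong inj₂ (cast-injective (K₁s-size m) (iso-injective e))

  contains⇒induced : Contains G (Pat m) → InducedP₃K₁ ⟦ G ⟧ m
  contains⇒induced (h , h-injective , h-adj) = record
    { a = h (pathV zero) ; b = h (pathV (suc zero)) ; c = h (pathV (suc (suc zero)))
    ; isolated = h ∘ isoV
    ; a~b = trans (h-adj _ _) (⊔ᴳ-left P₃ K zero (suc zero))
    ; b~c = trans (h-adj _ _) (⊔ᴳ-left P₃ K (suc zero) (suc (suc zero)))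
    ; a≁c = trans (h-adj _ _) (⊔ᴳ-left P₃ K zero (suc (suc zero)))
    ; a≢c = λ e → 0≢2 (inj₁-injective (join-injective 3 (V K) (h-injective e)))
    ; a≁iso = λ t → trans (h-adj _ (isoV t)) (⊔ᴳ-cross P₃ K zero (index t))
    ; b≁iso = λ t → trans (h-adj _ (isoV t)) (⊔ᴳ-cross P₃ K (suc zero) (index t))
    ; c≁iso = λ t → trans (h-adj _ (isoV t)) (⊔ᴳ-cross P₃ K (suc (suc zero)) (index t))
    ; iso≁iso = λ t u → trans (h-adj (isoV t) (isoV u)) (trans (⊔ᴳ-right P₃ K _ _) (K₁s-edgeless m _ _))
    ; iso-injective =
        cast-injective (sym (K₁s-size m)) ∘ inj₂-injective ∘ join-injective 3 (V K) ∘ h-injective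
    }
    where
    pathV : Fin 3 → Fin (V (Pat m))
    pathV p = join 3 (V K) (inj₁ p)
    index : Fin m → Fin (V K)
    index = cast (sym (K₁s-size m))
    0≢2 : (Fin 3 ∋ zero) ≢ suc (suc zero)
    0≢2 ()

  contains⇔induced : Contains G (Pat m) ⇔ InducedP₃K₁ ⟦ G ⟧ m
  contains⇔induced = mk⇔ contains⇒induced induced⇒contains

Within : ∀ {S m} → (Carrier S → Set) → InducedP₃K₁ S m → Set
Within U W = U a × U b × U c × (∀ t → U (isolated t))
  where open InducedP₃K₁ W

Within-map : ∀ {S m} {U U' : Carrier S → Set} → (∀ {v} → U v → U' v) →
  (W : InducedP₃K₁ S m) → Within U W → Within U' W
Within-map h W (ua , ub , uc , uiso) = h ua , h ub , h uc , h ∘ uiso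

module _ (S : Structure) (U : Carrier S → Set) where

  U-apart : Carrier S → Carrier S → Set
  U-apart x v = Apart S v x × U v

  add-isolated : ∀ {m x} → U x → (W : InducedP₃K₁ S m) → Within (U-apart x) W →
    Σ (InducedP₃K₁ S (suc m)) (Within U)
  add-isolated {m} {x} ux W (ua , ub , uc , uiso) =
    W' , proj₂ ua , proj₂ ub , proj₂ uc , λ { zero → ux ; (suc t) → proj₂ (uiso t) }
    where
    open InducedP₃K₁ W
    iso' : Fin (suc m) → Carrier S
    iso' zero    = x
    iso' (suc t) = isolated t
    path≁iso' : ∀ {v} → U-apart x v → (∀ t → v ~⟨ S ⟩ isolated t ≡ false) →
      ∀ t → v ~⟨ S ⟩ iso' t ≡ false
    path≁iso' v-x v≁iso zero    = proj₂ (proj₁ v-x)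
    path≁iso' v-x v≁iso (suc t) = v≁iso t
    iso≁iso' : ∀ t u → iso' t ~⟨ S ⟩ iso' u ≡ false
    iso≁iso' zero    zero    = ~-irrefl S x
    iso≁iso' zero    (suc u) = proj₂ (apart-sym S (proj₁ (uiso u)))
    iso≁iso' (suc t) zero    = proj₂ (proj₁ (uiso t))
    iso≁iso' (suc t) (suc u) = iso≁iso t u
    iso'-injective : ∀ {t u} → iso' t ≡ iso' u → t ≡ u
    iso'-injective {zero}  {zero}  _ = refl
    iso'-injective {zero}  {suc u} e = ⊥-elim (proj₁ (proj₁ (uiso u)) (sym e))
    iso'-injective {suc t} {zero}  e = ⊥-elim (proj₁ (proj₁ (uiso t)) e)
    iso'-injective {suc t} {suc u} e = cong suc (iso-injective e)
    W' : InducedP₃K₁ S (suc m)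
    W' = record
      { a = a ; b = b ; c = c ; isolated = iso'
      ; a~b = a~b ; b~c = b~c ; a≁c = a≁c ; a≢c = a≢c
      ; a≁iso = path≁iso' ua a≁iso ; b≁iso = path≁iso' ub b≁iso ; c≁iso = path≁iso' uc c≁iso
      ; iso≁iso = iso≁iso' ; iso-injective = iso'-injective
      }

  remove-isolated : ∀ {m} (W : InducedP₃K₁ S (suc m)) → Within U W →
    Σ (Carrier S) λ x → U x × Σ (InducedP₃K₁ S m) (Within (U-apart x))
  remove-isolated {m} W (ua , ub , uc , uiso) =
    x , uiso zero , W' ,
    (path-apart-iso W zero zero , ua) , (path-apart-iso W (suc zero) zero , ub) ,
    (path-apart-iso W (suc (suc zero)) zero , uc) , λ t → iso-apart-x t , uiso (suc t)
    where
    open InducedP₃K₁ W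
    x : Carrier S
    x = isolated zero
    iso-apart-x : ∀ t → Apart S (isolated (suc t)) x
    iso-apart-x t = (λ e → suc≢zero (iso-injective e)) , iso≁iso (suc t) zero
      where suc≢zero : (Fin (suc m) ∋ suc t) ≢ zero
            suc≢zero ()
    W' : InducedP₃K₁ S m
    W' = record
      { a = a ; b = b ; c = c ; isolated = isolated ∘ suc
      ; a~b = a~b ; b~c = b~c ; a≁c = a≁c ; a≢c = a≢c
      ; a≁iso = a≁iso ∘ suc ; b≁iso = b≁iso ∘ suc ; c≁iso = c≁iso ∘ suc
      ; iso≁iso = λ t u → iso≁iso (suc t) (suc u) ; iso-injective = suc-injective ∘ iso-injective
      }

  p₃⊔k₁ : ∀ {a b c d} → U a → U b → U c → U d →
    a ~⟨ S ⟩ b ≡ true → b ~⟨ S ⟩ c ≡ true → Apart S a c →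
    d ~⟨ S ⟩ a ≡ false → d ~⟨ S ⟩ b ≡ false → d ~⟨ S ⟩ c ≡ false →
    Σ (InducedP₃K₁ S 1) (Within U)
  p₃⊔k₁ {a} {b} {c} {d} ua ub uc ud a~b b~c (a≢c , a≁c) d≁a d≁b d≁c = W , ua , ub , uc , λ _ → ud
    where
    W : InducedP₃K₁ S 1
    W = record
      { a = a ; b = b ; c = c ; isolated = λ _ → d
      ; a~b = a~b ; b~c = b~c ; a≁c = a≁c ; a≢c = a≢c
      ; a≁iso = λ _ → trans (~-sym S a d) d≁a
      ; b≁iso = λ _ → trans (~-sym S b d) d≁b
      ; c≁iso = λ _ → trans (~-sym S c d) d≁c
      ; iso≁iso = λ _ _ → ~-irrefl S d
      ; iso-injective = λ { {zero} {zero} _ → refl }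
      }

  -- The configuration asserted by the core formula of depth 3, inside U:
  -- an independent triple x, y₁, z₁, a vertex y ~ x, a vertex z apart from
  -- x and y, and a vertex w apart from x with w ~ y.
  record CoreWitness : Set where
    field
      x y₁ z₁ y z w : Carrier S
      ux  : U x
      uy₁ : U y₁
      uz₁ : U z₁
      uy  : U y
      uz  : U z
      uw  : U w
      y₁-x  : Apart S y₁ x
      z₁-x  : Apart S z₁ x
      z₁-y₁ : Apart S z₁ y₁
      y~x   : y ~⟨ S ⟩ x ≡ true
      z-x   : Apart S z x
      z-y   : Apart S z y
      w-x   : Apart S w x
      w~y   : w ~⟨ S ⟩ y ≡ true

  -- every induced P₃ ⊔ K₁ inside U is a core configuration: x = a, y = b,
  -- w = c, and the isolated vertex d serves as both y₁ and z, with z₁ = c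
  core-example : Σ (InducedP₃K₁ S 1) (Within U) → CoreWitness
  core-example (W , ua , ub , uc , uiso) = record
    { x = a ; y₁ = d ; z₁ = c ; y = b ; z = d ; w = c
    ; ux = ua ; uy₁ = uiso zero ; uz₁ = uc ; uy = ub ; uz = uiso zero ; uw = uc
    ; y₁-x = apart-sym S (path-apart-iso W zero zero) ; z₁-x = apart-sym S (a≢c , a≁c)
    ; z₁-y₁ = path-apart-iso W (suc (suc zero)) zero
    ; y~x = trans (~-sym S b a) a~b
    ; z-x = apart-sym S (path-apart-iso W zero zero) ; z-y = apart-sym S (path-apart-iso W (suc zero) zero)
    ; w-x = apart-sym S (a≢c , a≁c) ; w~y = trans (~-sym S c b) b~c
    }
    where
    open InducedP₃K₁ W
    d : Carrier S
    d = isolated zero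

module _ (S : Structure) (_≟ₛ_ : DecidableEquality (Carrier S)) (U : Carrier S → Set) where

  module OnInducedPath {x y w z} (ux : U x) (uy : U y) (uw : U w) (uz : U z)
    (y~x : y ~⟨ S ⟩ x ≡ true) (w~y : w ~⟨ S ⟩ y ≡ true) (w~z : w ~⟨ S ⟩ z ≡ true)
    (w-x : Apart S w x) (z-x : Apart S z x) (z-y : Apart S z y) where

    classify : ∀ {u} → U u → Apart S u x →
      Σ (InducedP₃K₁ S 1) (Within U) ⊎ (u ≡ z ⊎ u ~⟨ S ⟩ z ≡ true)
    classify {u} uu u-x with u ~⟨ S ⟩ y in u~y
    ... | true with u ~⟨ S ⟩ z ≟ᵇ true
    ...   | yes u~z = inj₂ (inj₂ u~z)
    ...   | no  u≁z = inj₁ (p₃⊔k₁ S U uu uy ux uz u~y y~x u-x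
                        (trans (~-sym S z u) (¬-not u≁z)) (proj₂ z-y) (proj₂ z-x))
    classify {u} uu u-x | false with u ~⟨ S ⟩ w in u~w
    ... | false = inj₁ (p₃⊔k₁ S U uw uy ux uu w~y y~x w-x u~w u~y (proj₂ u-x))
    ... | true with u ≟ₛ z | u ~⟨ S ⟩ z ≟ᵇ true
    ...   | yes u≡z | _       = inj₂ (inj₁ u≡z)
    ...   | no  _   | yes u~z = inj₂ (inj₂ u~z)
    ...   | no  u≢z | no  u≁z = inj₁ (p₃⊔k₁ S U uu uw uz ux u~w w~z (u≢z , ¬-not u≁z)
                                  (proj₂ (apart-sym S u-x)) (proj₂ (apart-sym S w-x)) (proj₂ (apart-sym S z-x)))

  -- The core configuration forces an induced P₃ ⊔ K₁: either x - y - w with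
  -- z, or (when w ~ z) y₁ and z₁ are both adjacent to z, giving y₁ - z - z₁
  -- with x.
  core-lemma : CoreWitness S U → Σ (InducedP₃K₁ S 1) (Within U)
  core-lemma cw = by-w~z (w ~⟨ S ⟩ z) refl
    where
    open CoreWitness cw
    by-w~z : ∀ β → w ~⟨ S ⟩ z ≡ β → Σ (InducedP₃K₁ S 1) (Within U)
    by-w~z false w≁z = p₃⊔k₁ S U ux uy uw uz (trans (~-sym S x y) y~x) (trans (~-sym S y w) w~y)
                         (apart-sym S w-x) (proj₂ z-x) (proj₂ z-y) (trans (~-sym S z w) w≁z)
    by-w~z true w~z with classify uy₁ y₁-x | classify uz₁ z₁-x
      where open OnInducedPath ux uy uw uz y~x w~y w~z w-x z-x z-y
    ... | inj₁ copy | _ = copy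
    ... | _ | inj₁ copy = copy
    ... | inj₂ (inj₁ y₁≡z) | inj₂ (inj₁ z₁≡z) =
      ⊥-elim (proj₁ z₁-y₁ (trans z₁≡z (sym y₁≡z)))
    ... | inj₂ (inj₁ refl) | inj₂ (inj₂ z₁~z) = ⊥-elim (true-and-false z₁~z (proj₂ z₁-y₁))
    ... | inj₂ (inj₂ y₁~z) | inj₂ (inj₁ refl) =
      ⊥-elim (true-and-false (trans (~-sym S z y₁) y₁~z) (proj₂ z₁-y₁))
    ... | inj₂ (inj₂ y₁~z) | inj₂ (inj₂ z₁~z) =
      p₃⊔k₁ S U uy₁ uz uz₁ ux y₁~z (trans (~-sym S z z₁) z₁~z) (apart-sym S z₁-y₁)
        (proj₂ (apart-sym S y₁-x)) (proj₂ (apart-sym S z-x)) (proj₂ (apart-sym S z₁-x))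

apartF : ∀ {k} → Fin k → Fin k → Formula k
apartF u v = (¬' (u ≐ v)) ∧' (¬' (u ∼ v))

apartAll : ∀ {k k'} → Fin k' → (Fin k → Fin k') → Formula k'
apartAll {zero}  v e = v ≐ v
apartAll {suc k} v e = apartF v (e zero) ∧' apartAll v (e ∘ suc)

-- "the newest variable is apart from the k outer variables", below j + 1 binders
fresh : ∀ {k} j → Formula (suc j + k)
fresh j = apartAll zero (suc j ↑ʳ_)

v₀ : ∀ {k} → Fin (suc k)
v₀ = zero
v₁ : ∀ {k} → Fin (suc (suc k))
v₁ = suc zero
v₂ : ∀ {k} → Fin (suc (suc (suc k)))
v₂ = suc (suc zero)

-- The core formula of depth 3: a core configuration (CoreWitness) among
-- the vertices apart from the k outer variables,
--   ∃x. (∃y₁ ∃z₁. {x, y₁, z₁} independent) ∧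
--       (∃y ~ x. (∃z apart from x, y) ∧ (∃w apart from x with w ~ y)).
core : ∀ {k} → Formula k
core {k} = ∃' (fresh 0 ∧' ((∃' independent) ∧' (∃' path)))
  where
  -- here v₀ is y₁ (resp. y) and v₁ is x; under one more ∃ the new vertex
  -- (z₁, z or w) is v₀ and the others move to v₁, v₂
  independent : Formula (2 + k)
  independent = fresh 1 ∧' (apartF v₀ v₁ ∧' (∃' (fresh 2 ∧' (apartF v₀ v₁ ∧' apartF v₀ v₂))))
  path : Formula (2 + k)
  path = fresh 1 ∧' ((v₀ ∼ v₁) ∧' ((∃' (fresh 2 ∧' (apartF v₀ v₁ ∧' apartF v₀ v₂)))
                                 ∧' (∃' (fresh 2 ∧' (apartF v₀ v₂ ∧' (v₀ ∼ v₁))))))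

ψ : ℕ → ∀ {k} → Formula k
ψ zero    = core
ψ (suc n) = ∃' (fresh 0 ∧' ψ n)

qd-apartAll : ∀ {k k'} (v : Fin k') (e : Fin k → Fin k') → qd (apartAll v e) ≡ 0
qd-apartAll {zero}  v e = refl
qd-apartAll {suc k} v e = qd-apartAll v (e ∘ suc)

qd-core : ∀ {k} → qd (core {k}) ≡ 3
qd-core {k} rewrite qd-apartAll {k} {1 + k} zero (1 ↑ʳ_)
                  | qd-apartAll {k} {2 + k} zero (2 ↑ʳ_)
                  | qd-apartAll {k} {3 + k} zero (3 ↑ʳ_) = refl

qd-ψ : ∀ n {k} → qd (ψ n {k}) ≡ 3 + n
qd-ψ zero    {k} = qd-core {k}
qd-ψ (suc n) {k} rewrite qd-apartAll {k} {1 + k} zero (1 ↑ʳ_) | qd-ψ n {suc k} = refl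

module _ (G : Graph) where
  private
    S : Structure
    S = ⟦ G ⟧

  Fresh : ∀ {k} → (Fin k → Fin (V G)) → Fin (V G) → Set
  Fresh ρ v = ∀ i → Apart S v (ρ i)

  fresh-extend : ∀ {k} {ρ : Fin k → Fin (V G)} {x v} → Fresh (extend ρ x) v → U-apart S (Fresh ρ) x v
  fresh-extend fr = fr zero , fr ∘ suc

  extend-fresh : ∀ {k} {ρ : Fin k → Fin (V G)} {x v} → U-apart S (Fresh ρ) x v → Fresh (extend ρ x) v
  extend-fresh (v-x , _)  zero    = v-x
  extend-fresh (_ , fr) (suc i) = fr i

  -- Sat G (apartF u v) τ unfolds to the left-hand side
  sat→apart : ∀ {x y} → x ≢ y × ¬ (adj G x y ≡ true) → Apart S x y
  sat→apart (x≢y , x≁y) = x≢y , ¬-not x≁y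

  apart→sat : ∀ {x y} → Apart S x y → x ≢ y × ¬ (adj G x y ≡ true)
  apart→sat (x≢y , x≁y) = x≢y , λ x~y → true-and-false x~y x≁y

  apartAll-sat : ∀ {k k'} (v : Fin k') (e : Fin k → Fin k') {τ} →
    Sat G (apartAll v e) τ ⇔ (∀ i → Apart S (τ v) (τ (e i)))
  apartAll-sat {zero}  v e = mk⇔ (λ _ ()) (λ _ → refl)
  apartAll-sat {suc k} v e = mk⇔
    (λ (first , rest) → λ { zero → sat→apart first ; (suc i) → to (apartAll-sat v (e ∘ suc)) rest i })
    (λ all → apart→sat (all zero) , from (apartAll-sat v (e ∘ suc)) (all ∘ suc))

  fresh-sat : ∀ {k} j {τ : Fin (suc j + k) → Fin (V G)} →
    Sat G (fresh j) τ ⇔ (∀ i → Apart S (τ zero) (τ (suc j ↑ʳ i)))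
  fresh-sat j = apartAll-sat zero (suc j ↑ʳ_)

  core-sat : ∀ {k} (ρ : Fin k → Fin (V G)) → Sat G core ρ ⇔ CoreWitness S (Fresh ρ)
  core-sat {k} ρ = mk⇔
    (λ (x , fx , (y₁ , fy₁ , y₁-x , z₁ , fz₁ , z₁-y₁ , z₁-x) ,
        (y , fy , y~x , (z , fz , z-y , z-x) , (w , fw , w-x , w~y))) → record
      { x = x ; y₁ = y₁ ; z₁ = z₁ ; y = y ; z = z ; w = w
      ; ux = fr 0 fx ; uy₁ = fr 1 fy₁ ; uz₁ = fr 2 fz₁ ; uy = fr 1 fy ; uz = fr 2 fz ; uw = fr 2 fw
      ; y₁-x = sat→apart y₁-x ; z₁-x = sat→apart z₁-x ; z₁-y₁ = sat→apart z₁-y₁ ; y~x = y~x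
      ; z-x = sat→apart z-x ; z-y = sat→apart z-y ; w-x = sat→apart w-x ; w~y = w~y })
    (λ cw → let open CoreWitness cw in
      x , rf 0 ux ,
      (y₁ , rf 1 uy₁ , apart→sat y₁-x , z₁ , rf 2 uz₁ , apart→sat z₁-y₁ , apart→sat z₁-x) ,
      (y , rf 1 uy , y~x , (z , rf 2 uz , apart→sat z-y , apart→sat z-x) ,
        (w , rf 2 uw , apart→sat w-x , w~y)))
    where
    fr : ∀ j {τ : Fin (suc j + k) → Fin (V G)} →
      Sat G (fresh j) τ → ∀ i → Apart S (τ zero) (τ (suc j ↑ʳ i))
    fr j = to (fresh-sat j)
    rf : ∀ j {τ : Fin (suc j + k) → Fin (V G)} →
      (∀ i → Apart S (τ zero) (τ (suc j ↑ʳ i))) → Sat G (fresh j) τ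
    rf j = from (fresh-sat j)

  -- ψ n holds exactly when the fresh vertices contain an induced
  -- P₃ ⊔ (n+1) K₁: each leading quantifier picks one more isolated vertex.
  ψ-sat : ∀ n {k} (ρ : Fin k → Fin (V G)) →
    Sat G (ψ n) ρ ⇔ Σ (InducedP₃K₁ S (suc n)) (Within (Fresh ρ))
  ψ-sat zero ρ = mk⇔ (core-lemma S _≟_ (Fresh ρ) ∘ to (core-sat ρ))
                     (from (core-sat ρ) ∘ core-example S (Fresh ρ))
  ψ-sat (suc n) ρ = mk⇔
    (λ (x , fx , rest) → let (W , within) = to (ψ-sat n (extend ρ x)) rest in
      add-isolated S (Fresh ρ) (to (fresh-sat 0) fx) W
        (Within-map {U = Fresh (extend ρ x)} {U' = U-apart S (Fresh ρ) x} fresh-extend W within))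
    (λ (W , within) → let (x , fx , W' , within') = remove-isolated S (Fresh ρ) W within in
      x , from (fresh-sat 0) fx , from (ψ-sat n (extend ρ x))
        (W' , Within-map {U = U-apart S (Fresh ρ) x} {U' = Fresh (extend ρ x)} extend-fresh W' within'))

ψ-expresses : ∀ n → Expresses (ψ n) (Pat (suc n))
ψ-expresses n G = ⇔-sym (contains⇔induced G (suc n)) ⇔-∘ (forget-fresh ⇔-∘ ψ-sat G n (λ ()))
  where
  forget-fresh : Σ (InducedP₃K₁ ⟦ G ⟧ (suc n)) (Within (Fresh G (λ ()))) ⇔
                 InducedP₃K₁ ⟦ G ⟧ (suc n)
  forget-fresh = mk⇔ proj₁ (λ W → W , (λ ()) , (λ ()) , (λ ()) , λ _ ())

≟-sym : ∀ {n} (t t' : Fin n) → does (t ≟ t') ≡ does (t' ≟ t)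
≟-sym t t' with t ≟ t'
... | yes t≡t' = sym (dec-true (t' ≟ t) (sym t≡t'))
... | no  t≢t' = sym (dec-false (t' ≟ t) (t≢t' ∘ sym))

_⊕_ : Structure → Structure → Structure
S ⊕ T = record { Carrier = Carrier S ⊎ Carrier T ; _~_ = adj⊕ ; ~-sym = sym⊕ ; ~-irrefl = irrefl⊕ }
  where
  adj⊕ : Carrier S ⊎ Carrier T → Carrier S ⊎ Carrier T → Bool
  adj⊕ (inj₁ x) (inj₁ y) = x ~⟨ S ⟩ y
  adj⊕ (inj₂ x) (inj₂ y) = x ~⟨ T ⟩ y
  adj⊕ _        _        = false
  sym⊕ : ∀ x y → adj⊕ x y ≡ adj⊕ y x
  sym⊕ (inj₁ x) (inj₁ y) = ~-sym S x y
  sym⊕ (inj₁ x) (inj₂ y) = refl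
  sym⊕ (inj₂ x) (inj₁ y) = refl
  sym⊕ (inj₂ x) (inj₂ y) = ~-sym T x y
  irrefl⊕ : ∀ x → adj⊕ x x ≡ false
  irrefl⊕ (inj₁ x) = ~-irrefl S x
  irrefl⊕ (inj₂ x) = ~-irrefl T x

copies : ℕ → Structure → Structure
copies j S = record
  { Carrier  = Fin j × Carrier S
  ; _~_      = λ (t , x) (t' , y) → does (t ≟ t') ∧ x ~⟨ S ⟩ y
  ; ~-sym    = λ (t , x) (t' , y) → cong₂ _∧_ (≟-sym t t') (~-sym S x y)
  ; ~-irrefl = λ (t , x) → trans (cong (does (t ≟ t) ∧_) (~-irrefl S x)) (∧-zeroʳ _)
  }

copies-same : ∀ {j} S (t : Fin j) x y → (t , x) ~⟨ copies j S ⟩ (t , y) ≡ x ~⟨ S ⟩ y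
copies-same S t x y = cong (_∧ x ~⟨ S ⟩ y) (dec-true (t ≟ t) refl)

copies-different : ∀ {j} S {t t' : Fin j} x y → t ≢ t' → (t , x) ~⟨ copies j S ⟩ (t' , y) ≡ false
copies-different S {t} {t'} x y t≢t' = cong (_∧ x ~⟨ S ⟩ y) (dec-false (t ≟ t') t≢t')

copies-adjacent : ∀ {j} S {t t' : Fin j} {x y} → (t , x) ~⟨ copies j S ⟩ (t' , y) ≡ true →
  t ≡ t' × x ~⟨ S ⟩ y ≡ true
copies-adjacent S {t} {t'} t,x~t',y with t ≟ t'
... | yes t≡t' = t≡t' , t,x~t',y
... | no  _    = ⊥-elim (true-and-false t,x~t',y refl)

K₂ : Structure
K₂ = record
  { Carrier  = Fin 2
  ; _~_      = λ s s' → not (does (s ≟ s'))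
  ; ~-sym    = λ s s' → cong not (≟-sym s s')
  ; ~-irrefl = λ s → cong not (dec-true (s ≟ s) refl)
  }

K₂-distinct⇒adjacent : ∀ {s s'} → s ≢ s' → s ~⟨ K₂ ⟩ s' ≡ true
K₂-distinct⇒adjacent {s} {s'} s≢s' = cong not (dec-false (s ≟ s') s≢s')

K₂-two-vertices : ∀ (x y z : Fin 2) → x ≢ y → y ≢ z → x ≡ z
K₂-two-vertices zero       zero       _          x≢y _   = ⊥-elim (x≢y refl)
K₂-two-vertices (suc zero) (suc zero) _          x≢y _   = ⊥-elim (x≢y refl)
K₂-two-vertices _          zero       zero       _   y≢z = ⊥-elim (y≢z refl)
K₂-two-vertices _          (suc zero) (suc zero) _   y≢z = ⊥-elim (y≢z refl)
K₂-two-vertices zero       (suc zero) zero       _   _   = refl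
K₂-two-vertices (suc zero) zero       (suc zero) _   _   = refl

other : Fin 2 → Fin 2
other zero       = suc zero
other (suc zero) = zero

other-adjacent : ∀ s → other s ~⟨ K₂ ⟩ s ≡ true
other-adjacent zero       = refl
other-adjacent (suc zero) = refl

-- The 5-cycle: i ~ j iff one is the successor of the other modulo 5.  Facts
-- about this finite graph are checked by evaluating decision procedures.
c₅ : Fin 5 → Fin 5 → Bool
c₅ i j = does (toℕ j ≟ℕ suc (toℕ i) % 5) ∨ does (toℕ i ≟ℕ suc (toℕ j) % 5)

C₅ : Structure
C₅ = record
  { Carrier  = Fin 5
  ; _~_      = c₅
  ; ~-sym    = from-yes (all? λ x → all? λ y → c₅ x y ≟ᵇ c₅ y x)
  ; ~-irrefl = from-yes (all? λ x → c₅ x x ≟ᵇ false)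
  }

C₅-apart? : ∀ x y → Dec (Apart C₅ x y)
C₅-apart? x y = ¬? (x ≟ y) ×-dec (c₅ x y ≟ᵇ false)

C₅-non-neighbour : ∀ p → Σ (Fin 5) λ q → Apart C₅ q p
C₅-non-neighbour = from-yes (all? λ p → any? λ q → C₅-apart? q p)

C₅-P₃-dominating : ∀ p q r u → c₅ p q ≡ true → c₅ q r ≡ true → p ≢ r →
  ¬ (Apart C₅ p u × Apart C₅ q u × Apart C₅ r u)
C₅-P₃-dominating = from-yes (all? λ p → all? λ q → all? λ r → all? λ u →
  (c₅ p q ≟ᵇ true) →-dec (c₅ q r ≟ᵇ true) →-dec ¬? (p ≟ r) →-dec
  ¬? (C₅-apart? p u ×-dec C₅-apart? q u ×-dec C₅-apart? r u))

graphOf : (S : Structure) {N : ℕ} → Fin N ↔ Carrier S → Graph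
graphOf S {N} e = record
  { V      = N
  ; adj    = λ i j → Inverse.to e i ~⟨ S ⟩ Inverse.to e j
  ; sym    = λ i j → ~-sym S (Inverse.to e i) (Inverse.to e j)
  ; irrefl = λ i → ~-irrefl S (Inverse.to e i)
  }

graphOf-≅ : ∀ S {N} (e : Fin N ↔ Carrier S) → S ≅ ⟦ graphOf S e ⟧
graphOf-≅ S e = record
  { f = from' ; f⁻¹ = to' ; f∘f⁻¹ = strictlyInverseʳ ; f⁻¹∘f = strictlyInverseˡ
  ; f-adj = λ x y → cong₂ (adjacent S) (strictlyInverseˡ x) (strictlyInverseˡ y) }
  where open Inverse e renaming (to to to'; from to from')

CK : ℕ → Structure
CK j = C₅ ⊕ copies j K₂

CK-enumeration : ∀ j → Fin (5 + j * 2) ↔ Carrier (CK j)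
CK-enumeration j = ↔-trans +↔⊎ (↔-refl ⊎-↔ *↔×)

CKᴳ : ℕ → Graph
CKᴳ j = graphOf (CK j) (CK-enumeration j)

CK≅CKᴳ : ∀ j → CK j ≅ ⟦ CKᴳ j ⟧
CK≅CKᴳ j = graphOf-≅ (CK j) (CK-enumeration j)

apart-in-C₅ : ∀ {j p q} → Apart C₅ p q ⇔ Apart (CK j) (inj₁ p) (inj₁ q)
apart-in-C₅ = mk⇔ (λ (p≢q , p≁q) → p≢q ∘ inj₁-injective , p≁q)
                  (λ (p≢q , p≁q) → p≢q ∘ cong inj₁ , p≁q)

apart-sides : ∀ {j p} {w : Fin j × Fin 2} → Apart (CK j) (inj₁ p) (inj₂ w)
apart-sides = (λ ()) , refl

apart-copies : ∀ {j} {t t' : Fin j} {s s'} → t ≢ t' → Apart (CK j) (inj₂ (t , s)) (inj₂ (t' , s'))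
apart-copies {s = s} {s'} t≢t' = t≢t' ∘ ,-injectiveˡ ∘ inj₂-injective , copies-different K₂ s s' t≢t'

a-copy : ∀ m → InducedP₃K₁ (CK m) m
a-copy m = record
  { a = inj₁ zero ; b = inj₁ (suc zero) ; c = inj₁ (suc (suc zero))
  ; isolated = λ t → inj₂ (t , zero)
  ; a~b = refl ; b~c = refl ; a≁c = refl ; a≢c = λ ()
  ; a≁iso = λ _ → refl ; b≁iso = λ _ → refl ; c≁iso = λ _ → refl
  ; iso≁iso = λ t u → ∧-zeroʳ (does (t ≟ u))
  ; iso-injective = cong proj₁ ∘ inj₂-injective
  }

-- A vertex of C₅ ⊕ j K₂ apart from an induced path x - y - z lies in a K₂:
-- the path cannot cross between the sides (the missing cases), cannot lie in
-- one K₂ (it would have x = z), and a path in C₅ dominates C₅.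
apart-from-path : ∀ {j} (x y z v : Carrier (CK j)) →
  x ~⟨ CK j ⟩ y ≡ true → y ~⟨ CK j ⟩ z ≡ true → x ≢ z →
  Apart (CK j) x v → Apart (CK j) y v → Apart (CK j) z v → Σ (Fin j × Fin 2) λ w → v ≡ inj₂ w
apart-from-path _ _ _ (inj₂ w) _ _ _ _ _ _ = w , refl
apart-from-path (inj₁ p) (inj₁ q) (inj₁ r) (inj₁ u) p~q q~r p≢r p-u q-u r-u =
  ⊥-elim (C₅-P₃-dominating p q r u p~q q~r (p≢r ∘ cong inj₁)
            (from apart-in-C₅ p-u , from apart-in-C₅ q-u , from apart-in-C₅ r-u))
apart-from-path (inj₂ (t , s)) (inj₂ (t' , s')) (inj₂ (t'' , s'')) (inj₁ _) x~y y~z x≢z _ _ _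
  with copies-adjacent K₂ {t} {t'} {s} {s'} x~y | copies-adjacent K₂ {t'} {t''} {s'} {s''} y~z
... | refl , s~s' | refl , s'~s'' =
  ⊥-elim (x≢z (cong (λ s → inj₂ (t , s))
    (K₂-two-vertices s s' s'' (adjacent⇒distinct K₂ s~s') (adjacent⇒distinct K₂ s'~s''))))

-- C₅ ⊕ n K₂ contains no induced P₃ ⊔ (n+1) K₁: every isolated vertex lies
-- in some K₂, and no two in the same one (they would be equal or adjacent),
-- which is impossible with n + 1 isolated vertices and n copies of K₂.
no-copy : ∀ n → ¬ InducedP₃K₁ (CK n) (suc n)
no-copy n W = 1+n≰n (injective⇒≤ κ-injective)
  where
  open InducedP₃K₁ W

  in-K₂ : ∀ t → Σ (Fin n × Fin 2) λ w → isolated t ≡ inj₂ w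
  in-K₂ t = apart-from-path a b c (isolated t) a~b b~c a≢c
    (path-apart-iso W zero t) (path-apart-iso W (suc zero) t) (path-apart-iso W (suc (suc zero)) t)

  κ : Fin (suc n) → Fin n
  κ t = proj₁ (proj₁ (in-K₂ t))

  κ-injective : ∀ {t u} → κ t ≡ κ u → t ≡ u
  κ-injective {t} {u} κt≡κu with in-K₂ t | in-K₂ u
  ... | (i , s) , t↦ | (_ , s') , u↦ with s ≟ s' | κt≡κu
  ...   | yes refl | refl = iso-injective (trans t↦ (sym u↦))
  ...   | no  s≢s' | refl = ⊥-elim (true-and-false
          (trans (copies-same K₂ i s s') (K₂-distinct⇒adjacent s≢s'))
          (subst₂ (λ v w → v ~⟨ CK n ⟩ w ≡ false) t↦ u↦ (iso≁iso t u)))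

IsC₅ : ∀ {j} → Carrier (CK j) → Set
IsC₅ (inj₁ _) = ⊤
IsC₅ (inj₂ _) = ⊥

isC₅? : ∀ {j} (v : Carrier (CK j)) → Dec (IsC₅ v)
isC₅? (inj₁ _) = yes tt
isC₅? (inj₂ _) = no λ ()

InCopy : ∀ {j} → Fin j → Carrier (CK j) → Set
InCopy t (inj₁ _)        = ⊥
InCopy t (inj₂ (t' , _)) = t' ≡ t

inCopy? : ∀ {j} (t : Fin j) (v : Carrier (CK j)) → Dec (InCopy t v)
inCopy? t (inj₁ _)        = no λ ()
inCopy? t (inj₂ (t' , _)) = t' ≟ t

C₅-not-in-copy : ∀ {j} {t : Fin j} v → IsC₅ v → ¬ InCopy t v
C₅-not-in-copy (inj₁ _) _ ()

copy-unique : ∀ {j} {t t' : Fin j} v → InCopy t v → InCopy t' v → t ≡ t'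
copy-unique (inj₂ _) refl refl = refl

C₅-apart : ∀ {j} p (v : Carrier (CK j)) → ¬ IsC₅ v → Apart (CK j) (inj₁ p) v
C₅-apart p (inj₁ _) notC₅ = ⊥-elim (notC₅ tt)
C₅-apart p (inj₂ _) _     = apart-sides

Touched : ∀ {j k} → (Fin k → Carrier (CK j)) → Fin j → Set
Touched {k = k} σ t = Σ (Fin k) λ i → InCopy t (σ i)

count : ∀ {j k m} (σ : Fin k → Carrier (CK j)) → (∀ t → Touched σ t) →
  (g : Fin m → Fin k) → Injective _≡_ _≡_ g → (∀ x → IsC₅ (σ (g x))) → m + j ≤ k
count {j} {k} {m} σ touched g g-injective g-C₅ =
  injective⇒≤ (λ {x} {y} e → splitAt-injective m j (h-injective (splitAt m x) (splitAt m y) e))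
  where
  h : Fin m ⊎ Fin j → Fin k
  h = [ g , proj₁ ∘ touched ]
  meets : ∀ {t} i → h (inj₂ t) ≡ i → InCopy t (σ i)
  meets {t} i refl = proj₂ (touched t)
  h-injective : ∀ x y → h x ≡ h y → x ≡ y
  h-injective (inj₁ x) (inj₁ y) e = cong inj₁ (g-injective e)
  h-injective (inj₁ x) (inj₂ t) e = ⊥-elim (C₅-not-in-copy (σ (g x)) (g-C₅ x) (meets (g x) (sym e)))
  h-injective (inj₂ t) (inj₁ x) e = ⊥-elim (C₅-not-in-copy (σ (g x)) (g-C₅ x) (meets (g x) e))
  h-injective (inj₂ t) (inj₂ t') e =
    cong inj₂ (copy-unique (σ (h (inj₂ t))) (meets _ refl) (meets _ (sym e)))

module Strategy (n : ℕ) where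
  𝔾 ℍ : Structure
  𝔾 = CK (suc n)
  ℍ = CK n

  VG VH : Set
  VG = Carrier 𝔾
  VH = Carrier ℍ

  Relabelling : (Fin n → Fin (suc n)) → Set
  Relabelling ι = Injective _≡_ _≡_ ι

  lift : (Fin n → Fin (suc n)) → VH → VG
  lift ι (inj₁ p)       = inj₁ p
  lift ι (inj₂ (t , s)) = inj₂ (ι t , s)

  lift-injective : ∀ {ι} → Relabelling ι → ∀ {x y} → lift ι x ≡ lift ι y → x ≡ y
  lift-injective ι-inj {inj₁ p} {inj₁ _} refl = refl
  lift-injective ι-inj {inj₂ (t , s)} {inj₂ (t' , s')} e with ι-inj (,-injectiveˡ (inj₂-injective e))
  ... | refl = cong (λ s → inj₂ (t , s)) (,-injectiveʳ (inj₂-injective e))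

  lift-adj : ∀ {ι} → Relabelling ι → ∀ x y → lift ι x ~⟨ 𝔾 ⟩ lift ι y ≡ x ~⟨ ℍ ⟩ y
  lift-adj ι-inj (inj₁ p) (inj₁ q) = refl
  lift-adj ι-inj (inj₁ p) (inj₂ _) = refl
  lift-adj ι-inj (inj₂ _) (inj₁ q) = refl
  lift-adj {ι} ι-inj (inj₂ (t , s)) (inj₂ (t' , s')) = cong (_∧ s ~⟨ K₂ ⟩ s') same-copy
    where
    same-copy : does (ι t ≟ ι t') ≡ does (t ≟ t')
    same-copy with t ≟ t'
    ... | yes refl = dec-true (ι t ≟ ι t) refl
    ... | no  t≢t' = dec-false (ι t ≟ ι t') (t≢t' ∘ ι-inj)

  -- the invariant of the strategy: the G-position is the lift of the H-position
  Tracks : ∀ {k} → (Fin n → Fin (suc n)) → (Fin k → VG) → (Fin k → VH) → Set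
  Tracks ι ρ σ = ∀ i → ρ i ≡ lift ι (σ i)

  tracked-sameType : ∀ {ι} → Relabelling ι → ∀ {a x b y} → a ≡ lift ι b → x ≡ lift ι y →
    SameType 𝔾 ℍ a x b y
  tracked-sameType {ι} ι-inj {b = b} {y = y} refl refl =
    mk⇔ (lift-injective ι-inj) (cong (lift ι)) , lift-adj ι-inj b y

  tracks⇒partialIso : ∀ {ι k} {ρ : Fin k → VG} {σ} → Relabelling ι → Tracks ι ρ σ →
    PartialIso 𝔾 ℍ ρ σ
  tracks⇒partialIso ι-inj T i j = tracked-sameType ι-inj (T i) (T j)

  tracks-extend : ∀ {ι k} {ρ : Fin k → VG} {σ a b} → Tracks ι ρ σ → a ≡ lift ι b →
    Tracks ι (ρ ▷ a) (σ ▷ b)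
  tracks-extend T a≡ zero    = a≡
  tracks-extend T a≡ (suc i) = T i

  untouched-apart : ∀ {ι k} {ρ : Fin k → VG} {σ} → Tracks ι ρ σ → ∀ {c} → (∀ t → ι t ≢ c) →
    ∀ s i → Apart 𝔾 (inj₂ (c , s)) (ρ i)
  untouched-apart {σ = σ} T c∉ι s i rewrite T i with σ i
  ... | inj₁ _       = apart-sym 𝔾 apart-sides
  ... | inj₂ (t , _) = apart-copies (c∉ι t ∘ sym)

  redirect : (Fin n → Fin (suc n)) → Fin n → Fin (suc n) → Fin n → Fin (suc n)
  redirect ι t₀ c t with t ≟ t₀
  ... | yes _ = c
  ... | no  _ = ι t

  redirect-at : ∀ ι t₀ c → redirect ι t₀ c t₀ ≡ c
  redirect-at ι t₀ c with t₀ ≟ t₀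
  ... | yes _   = refl
  ... | no  t≢t = ⊥-elim (t≢t refl)

  redirect-elsewhere : ∀ ι {t₀ c t} → t ≢ t₀ → redirect ι t₀ c t ≡ ι t
  redirect-elsewhere ι {t₀} {t = t} t≢t₀ with t ≟ t₀
  ... | yes t≡t₀ = ⊥-elim (t≢t₀ t≡t₀)
  ... | no  _    = refl

  redirect-injective : ∀ {ι t₀ c} → Relabelling ι → (∀ t → ι t ≢ c) →
    Relabelling (redirect ι t₀ c)
  redirect-injective {ι} {t₀} {c} ι-inj c∉ι {t} {t'} e with t ≟ t₀ | t' ≟ t₀
  ... | yes t≡t₀ | yes t'≡t₀ = trans t≡t₀ (sym t'≡t₀)
  ... | yes _    | no  _     = ⊥-elim (c∉ι t' (sym e))
  ... | no  _    | yes _     = ⊥-elim (c∉ι t e)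
  ... | no  _    | no  _     = ι-inj e

  tracks-redirect : ∀ {ι k t₀ c} {ρ : Fin k → VG} {σ} → Tracks ι ρ σ → ¬ Touched σ t₀ →
    Tracks (redirect ι t₀ c) ρ σ
  tracks-redirect {ι} {t₀ = t₀} {σ = σ} T untouched i rewrite T i with σ i in σi
  ... | inj₁ _       = refl
  ... | inj₂ (t , s) = cong (λ x → inj₂ (x , s)) (sym (redirect-elsewhere ι t≢t₀))
    where
    t≢t₀ : t ≢ t₀
    t≢t₀ t≡t₀ = untouched (i , subst (InCopy t₀) (sym σi) t≡t₀)

  -- With every copy of K₂ in H touched and at most n + 1 pebbles, at most
  -- one vertex of C₅ is touched, so some vertex of C₅ is apart from σ.
  free-vertex : ∀ {k} (σ : Fin k → VH) → (∀ t → Touched σ t) → k ≤ suc n →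
    Σ VH λ b → ∀ i → Apart ℍ b (σ i)
  free-vertex {k} σ touched k≤ with any? (λ i → isC₅? (σ i))
  ... | no none = inj₁ zero , λ i → C₅-apart zero (σ i) (λ c → none (i , c))
  ... | yes (i₀ , _) with σ i₀ in σi₀
  ... | inj₁ p = inj₁ (proj₁ (C₅-non-neighbour p)) , apart
    where
    apart : ∀ i → Apart ℍ (inj₁ (proj₁ (C₅-non-neighbour p))) (σ i)
    apart i with σ i in σi
    ... | inj₂ _ = apart-sides
    ... | inj₁ p' with p' ≟ p
    ...   | yes refl = to apart-in-C₅ (proj₂ (C₅-non-neighbour p))
    ...   | no  p'≢p = ⊥-elim (1+n≰n (≤-trans (count σ touched g g-injective g-C₅) k≤))
      where
      g : Fin 2 → Fin k
      g zero       = i₀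
      g (suc zero) = i
      g-injective : Injective _≡_ _≡_ g
      g-injective {zero}     {zero}     _ = refl
      g-injective {suc zero} {suc zero} _ = refl
      g-injective {zero}     {suc zero} e =
        ⊥-elim (p'≢p (inj₁-injective (trans (sym σi) (trans (cong σ (sym e)) σi₀))))
      g-injective {suc zero} {zero}     e =
        ⊥-elim (p'≢p (inj₁-injective (trans (sym σi) (trans (cong σ e) σi₀))))
      g-C₅ : ∀ x → IsC₅ (σ (g x))
      g-C₅ zero       rewrite σi₀ = tt
      g-C₅ (suc zero) rewrite σi  = tt

  -- Two rounds before the end, with C₅ untouched, Spoiler has just played
  -- in an untouched copy c of K₂ in G; Duplicator answers with the vertex 0
  -- of C₅ in H, whose neighbours 1 and 4 stand in for the other vertex of
  -- copy c, and survives the last round.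
  module TwoRounds {ι k} {ρ : Fin k → VG} {σ} (ι-inj : Relabelling ι) (T : Tracks ι ρ σ)
    (σ∉C₅ : ∀ i → ¬ IsC₅ (σ i)) {c} (c∉ι : ∀ t → ι t ≢ c) (s : Fin 2) where
    a : VG
    a = inj₂ (c , s)
    b : VH
    b = inj₁ zero
    ρ∉C₅ : ∀ i → ¬ IsC₅ (ρ i)
    ρ∉C₅ i rewrite T i with σ i | σ∉C₅ i
    ... | inj₂ _ | _   = λ ()
    ... | inj₁ _ | ∉C₅ = ∉C₅
    both-apart : ∀ {a' b'} → (∀ i → Apart 𝔾 a' (ρ i)) → (∀ i → Apart ℍ b' (σ i)) →
      ∀ i → SameType 𝔾 ℍ a' (ρ i) b' (σ i)
    both-apart a'-ρ b'-σ i = apart-sameType 𝔾 ℍ (a'-ρ i) (b'-σ i)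
    tracked : ∀ {a' b'} → a' ≡ lift ι b' → ∀ i → SameType 𝔾 ℍ a' (ρ i) b' (σ i)
    tracked a'≡ i = tracked-sameType ι-inj a'≡ (T i)
    G-apart : ∀ p i → Apart 𝔾 (inj₁ p) (ρ i)
    G-apart p i = C₅-apart p (ρ i) (ρ∉C₅ i)
    H-apart : ∀ q i → Apart ℍ (inj₁ q) (σ i)
    H-apart q i = C₅-apart q (σ i) (σ∉C₅ i)
    P : PartialIso 𝔾 ℍ (ρ ▷ a) (σ ▷ b)
    P = partialIso-extend 𝔾 ℍ (tracks⇒partialIso ι-inj T)
          (both-apart (untouched-apart T c∉ι s) (H-apart zero))
    answer : ∀ {a' b'} → SameType 𝔾 ℍ a' a b' b → (∀ i → SameType 𝔾 ℍ a' (ρ i) b' (σ i)) →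
      EF 𝔾 ℍ 0 ((ρ ▷ a) ▷ a') ((σ ▷ b) ▷ b')
    answer new old = partialIso-extend 𝔾 ℍ P λ { zero → new ; (suc i) → old i }
    repeat : EF 𝔾 ℍ 0 ((ρ ▷ a) ▷ a) ((σ ▷ b) ▷ b)
    repeat = partialIso-extend 𝔾 ℍ P (P zero)
    two : Fin 5
    two = suc (suc zero)
    two-apart : Apart ℍ (inj₁ two) b
    two-apart = (λ ()) , refl

    forth : ∀ a' → Σ VH λ b' → EF 𝔾 ℍ 0 ((ρ ▷ a) ▷ a') ((σ ▷ b) ▷ b')
    forth (inj₁ p) = inj₁ two ,
      answer (apart-sameType 𝔾 ℍ apart-sides two-apart) (both-apart (G-apart p) (H-apart two))
    forth (inj₂ (c' , s')) with any? (λ t → ι t ≟ c')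
    ... | yes (t , ιt≡c') = inj₂ (t , s') ,
          answer (apart-sameType 𝔾 ℍ (apart-copies λ c'≡c → c∉ι t (trans ιt≡c' c'≡c))
                                     (apart-sym ℍ apart-sides))
                 (tracked (cong (λ x → inj₂ (x , s')) (sym ιt≡c')))
    ... | no c'∉ι with c' ≟ c
    ...   | no c'≢c = inj₁ two ,
            answer (apart-sameType 𝔾 ℍ (apart-copies c'≢c) two-apart)
                   (both-apart (untouched-apart T (λ t ιt≡c' → c'∉ι (t , ιt≡c')) s') (H-apart two))
    ...   | yes refl with s' ≟ s
    ...     | yes refl = b , repeat
    ...     | no  s'≢s = inj₁ (suc zero) ,
              answer (adjacent-sameType 𝔾 ℍ (trans (copies-same K₂ c s' s) (K₂-distinct⇒adjacent s'≢s))
                                            refl)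
                     (both-apart (untouched-apart T c∉ι s') (H-apart (suc zero)))

    back : ∀ b' → Σ VG λ a' → EF 𝔾 ℍ 0 ((ρ ▷ a) ▷ a') ((σ ▷ b) ▷ b')
    back (inj₂ (t , s')) = inj₂ (ι t , s') ,
      answer (apart-sameType 𝔾 ℍ (apart-copies (c∉ι t)) (apart-sym ℍ apart-sides)) (tracked refl)
    back (inj₁ q) with q ≟ zero | c₅ q zero ≟ᵇ true
    ... | yes refl | _       = a , repeat
    ... | no  q≢0  | yes q~0 = inj₂ (c , other s) ,
          answer (adjacent-sameType 𝔾 ℍ (trans (copies-same K₂ c (other s) s) (other-adjacent s)) q~0)
                 (both-apart (untouched-apart T c∉ι (other s)) (H-apart q))
    ... | no  q≢0  | no  q≁0 = inj₁ zero ,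
          answer (apart-sameType 𝔾 ℍ apart-sides (to apart-in-C₅ (q≢0 , ¬-not q≁0)))
                 (both-apart (G-apart zero) (H-apart q))

  two-rounds : ∀ {ι k} {ρ : Fin k → VG} {σ} → Relabelling ι → Tracks ι ρ σ → (∀ i → ¬ IsC₅ (σ i)) →
    ∀ {c} → (∀ t → ι t ≢ c) → ∀ s → EF 𝔾 ℍ 1 (ρ ▷ inj₂ (c , s)) (σ ▷ inj₁ zero)
  two-rounds ι-inj T σ∉C₅ c∉ι s = P , forth , back
    where open TwoRounds ι-inj T σ∉C₅ c∉ι s

  -- Spoiler plays in a copy c of K₂ in G outside the image of ι while every
  -- copy of K₂ in H is touched, so k ≥ n and at most one more round follows:
  -- a last round is survived by a free vertex of H, and in the case of two
  -- rounds C₅ is still untouched, so two-rounds applies.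
  endgame : ∀ r {ι k} {ρ : Fin k → VG} {σ} → Relabelling ι → Tracks ι ρ σ → (∀ t → Touched σ t) →
    suc r + k ≤ 2 + n → ∀ {c} → (∀ t → ι t ≢ c) →
    ∀ s → Σ VH λ b → EF 𝔾 ℍ r (ρ ▷ inj₂ (c , s)) (σ ▷ b)
  endgame zero {σ = σ} ι-inj T touched bound c∉ι s =
    proj₁ free , partialIso-extend 𝔾 ℍ (tracks⇒partialIso ι-inj T)
                   (λ i → apart-sameType 𝔾 ℍ (untouched-apart T c∉ι s i) (proj₂ free i))
    where
    free : Σ VH λ b → ∀ i → Apart ℍ b (σ i)
    free = free-vertex σ touched (s≤s⁻¹ bound)
  endgame (suc zero) {σ = σ} ι-inj T touched bound c∉ι s = inj₁ zero , two-rounds ι-inj T σ∉C₅ c∉ι s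
    where
    σ∉C₅ : ∀ i → ¬ IsC₅ (σ i)
    σ∉C₅ i i∈C₅ =
      1+n≰n (≤-trans (count σ touched (λ _ → i) (λ { {zero} {zero} _ → refl }) (λ _ → i∈C₅))
                     (s≤s⁻¹ (s≤s⁻¹ bound)))
  endgame (suc (suc r)) {k = k} {σ = σ} ι-inj T touched bound c∉ι s =
    ⊥-elim (1+n≰n (≤-trans (s≤s⁻¹ (s≤s⁻¹ bound)) (≤-trans n≤k (m≤n+m k r))))
    where
    n≤k : n ≤ k
    n≤k = count σ touched (λ ()) (λ { {()} }) (λ ())

  -- The tracking strategy survives r more rounds from a tracked position
  -- with k pebbles whenever r + k ≤ n + 2: moves in C₅ and in tracked
  -- copies are copied, a move in a fresh copy of G is matched by redirecting
  -- an untouched copy of H, and if there is none the endgame takes over.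
  tracking : ∀ r {k} {ρ : Fin k → VG} {σ} ι → Relabelling ι → Tracks ι ρ σ → r + k ≤ 2 + n →
    EF 𝔾 ℍ r ρ σ
  tracking zero    ι ι-inj T _ = tracks⇒partialIso ι-inj T
  tracking (suc r) {k} {ρ} {σ} ι ι-inj T bound = tracks⇒partialIso ι-inj T , forth , back
    where
    continue : ∀ {a b} ι' → Relabelling ι' → Tracks ι' (ρ ▷ a) (σ ▷ b) →
      EF 𝔾 ℍ r (ρ ▷ a) (σ ▷ b)
    continue ι' ι'-inj T' = tracking r ι' ι'-inj T' (subst (_≤ 2 + n) (sym (+-suc r k)) bound)
    back : ∀ b → Σ VG λ a → EF 𝔾 ℍ r (ρ ▷ a) (σ ▷ b)
    back b = lift ι b , continue ι ι-inj (tracks-extend T refl)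
    forth : ∀ a → Σ VH λ b → EF 𝔾 ℍ r (ρ ▷ a) (σ ▷ b)
    forth (inj₁ p) = inj₁ p , continue ι ι-inj (tracks-extend T refl)
    forth (inj₂ (c , s)) with any? (λ t → ι t ≟ c)
    ... | yes (t , ιt≡c) = inj₂ (t , s) ,
          continue ι ι-inj (tracks-extend T (cong (λ x → inj₂ (x , s)) (sym ιt≡c)))
    ... | no  c∉im with all? (λ t → any? (λ i → inCopy? t (σ i)))
    ...   | yes touched = endgame r ι-inj T touched bound (λ t ιt≡c → c∉im (t , ιt≡c)) s
    ...   | no  not-all with ¬∀⟶∃¬ n _ (λ t → any? (λ i → inCopy? t (σ i))) not-all
    ...     | t₀ , t₀-untouched = inj₂ (t₀ , s) ,
              continue (redirect ι t₀ c) (redirect-injective ι-inj c∉ι)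
                (tracks-extend (tracks-redirect T t₀-untouched)
                               (cong (λ x → inj₂ (x , s)) (sym (redirect-at ι t₀ c))))
      where
      c∉ι : ∀ t → ι t ≢ c
      c∉ι t ιt≡c = c∉im (t , ιt≡c)

-- Duplicator survives n + 2 rounds on C₅ ⊔ (n+1) K₂ and C₅ ⊔ n K₂, starting
-- by assigning the copies of K₂ in H to the copies 1, …, n in G.
duplicator-wins : ∀ n → EF ⟦ CKᴳ (suc n) ⟧ ⟦ CKᴳ n ⟧ (2 + n) {0} (λ ()) (λ ())
duplicator-wins n = EF-transport (CK≅CKᴳ (suc n)) (CK≅CKᴳ n) (2 + n) {ρ = λ ()} {σ = λ ()} (λ ()) (λ ())
  (tracking (2 + n) suc suc-injective (λ ()) (≤-reflexive (+-identityʳ (2 + n))))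
  where open Strategy n

separated : ∀ n → Contains (CKᴳ (suc n)) (Pat (suc n)) × ¬ Contains (CKᴳ n) (Pat (suc n))
separated n =
  from (contains⇔induced (CKᴳ (suc n)) (suc n)) (induced-transport (CK≅CKᴳ (suc n)) (a-copy (suc n))) ,
  no-copy n ∘ induced-transport (≅-sym (CK≅CKᴳ n)) ∘ to (contains⇔induced (CKᴳ n) (suc n))

lower-bound : ∀ n φ → Expresses φ (Pat (suc n)) → 3 + n ≤ qd φ
lower-bound n = depth-lower-bound (Pat (suc n)) (CKᴳ (suc n)) (CKᴳ n) (2 + n)
  (duplicator-wins n) (proj₁ (separated n)) (proj₂ (separated n))

theorem2 : ∀ (m : ℕ) → 1 ≤ m →
    D[ P₃ ⊔ᴳ (m ·ᴳ K₁) ]≡ (v (P₃ ⊔ᴳ (m ·ᴳ K₁)) ∸ 1)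
theorem2 zero    ()
theorem2 (suc n) _ =
  (ψ n , trans (qd-ψ n) (sym v-1) , ψ-expresses n) ,
  (λ φ expr → subst (_≤ qd φ) (sym v-1) (lower-bound n φ expr))
  where
  v-1 : v (Pat (suc n)) ∸ 1 ≡ 3 + n
  v-1 = cong (3 +_) (K₁s-size n)
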